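{- The graph $F(9,15,17)$ on vertex set $\{1,\dots,9\}$ with edges $\{4,6\},\{1,4\},\{1,2\},\{2,3\},\{3,6\},\{5,6\},\{1,3\},\{4,5\},\{2,8\},\{2,7\},\{7,8\},\{3,8\},\{7,9\},\{8,9\},\{5,9\}$ is forbidden.
   Context: All graphs are finite and simple. A graph $G$ with vertex set $V$ is unit-distance if there exists an injective map $\varphi\colon V\to\mathbf{R}^2$ with $|\varphi(v)-\varphi(w)|=1$ for every pair of adjacent vertices $v,w$ (non-adjacent vertices may also be at distance 1). A graph is forbidden if it is not unit-distance. -}

module Defs where

open import Level using (0ℓ)
open import Data.Nat using (ℕ)
open import Data.Fin using (Fin; #_)
open import Data.List using (List; []; _∷_)
open import Data.List.Membership.Propositional using (_∈_)
open import Data.Product using (_×_; _,_; ∃)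
open import Relation.Nullary using (¬_)
open import Relation.Binary.PropositionalEquality using (_≡_)
open import Relation.Binary.Structures using (IsTotalOrder)
open import Algebra.Bundles using (CommutativeRing)

-- An axiomatisation of the real numbers: a complete ordered field.
-- (Any two models are isomorphic, so quantifying over all models is the
-- same as talking about ℝ.)
record RealNumbers : Set₁ where
  field
    commRing : CommutativeRing 0ℓ 0ℓ
  open CommutativeRing commRing public
  field
    0≉1      : ¬ (0# ≈ 1#)
    inverse  : ∀ x → ¬ (x ≈ 0#) → ∃ λ y → x * y ≈ 1#
    _≤_      : Carrier → Carrier → Set
    isTotalOrder : IsTotalOrder _≈_ _≤_
    +-mono-≤ : ∀ {x y} z → x ≤ y → (x + z) ≤ (y + z)
    *-nonneg : ∀ {x y} → 0# ≤ x → 0# ≤ y → 0# ≤ (x * y)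
    lub : (P : Carrier → Set) → ∃ P → ∃ (λ b → ∀ x → P x → x ≤ b) →
          ∃ λ s → (∀ x → P x → x ≤ s) ×
                  (∀ b → (∀ x → P x → x ≤ b) → s ≤ b)

Graph : ℕ → Set
Graph n = List (Fin n × Fin n)

module _ (ℝ : RealNumbers) where
  open RealNumbers ℝ

  Point : Set
  Point = Carrier × Carrier

  _≈ₚ_ : Point → Point → Set
  (x₁ , y₁) ≈ₚ (x₂ , y₂) = (x₁ ≈ x₂) × (y₁ ≈ y₂)

  dist² : Point → Point → Carrier
  dist² (x₁ , y₁) (x₂ , y₂) =
    ((x₁ - x₂) * (x₁ - x₂)) + ((y₁ - y₂) * (y₁ - y₂))

  -- an injective map into ℝ² with adjacent vertices at distance 1
  -- (|p - q| = 1 iff |p - q|² = 1, since distances are nonnegative)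
  UnitDistanceEmbedding : ∀ {n} → Graph n → (Fin n → Point) → Set
  UnitDistanceEmbedding {n} G φ =
    (∀ v w → φ v ≈ₚ φ w → v ≡ w) ×
    (∀ v w → (v , w) ∈ G → dist² (φ v) (φ w) ≈ 1#)

  UnitDistance : ∀ {n} → Graph n → Set
  UnitDistance {n} G = ∃ λ (φ : Fin n → Point) → UnitDistanceEmbedding G φ

Forbidden : ∀ {n} → Graph n → Set₁
Forbidden G = (ℝ : RealNumbers) → ¬ UnitDistance ℝ G

-- F(9,15,17); vertex i of the paper is (i - 1) : Fin 9.
F-9-15-17 : Graph 9
F-9-15-17 =
  (# 3 , # 5) ∷ (# 0 , # 3) ∷ (# 0 , # 1) ∷ (# 1 , # 2) ∷ (# 2 , # 5) ∷ (# 4 , # 5) ∷ (# 0 , # 2) ∷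
  (# 3 , # 4) ∷ (# 1 , # 7) ∷ (# 1 , # 6) ∷ (# 6 , # 7) ∷ (# 2 , # 7) ∷ (# 6 , # 8) ∷ (# 7 , # 8) ∷
  (# 4 , # 8) ∷ []

module Submission where

-- Vertices 0, 1, 2 form a unit triangle O, A, B.  Measuring a point p by
-- E p = (2⟨p - O, A - O⟩, 2⟨p - O, B - O⟩) turns three times the squared
-- distance into the Eisenstein norm N(u) = u₁² - u₁u₂ + u₂², so unit
-- distance becomes N = 3 and 0, 1, 2 sit at (0,0), (2,1), (1,2).  In these
-- coordinates four general facts do all the work:
--   * rhombus: A ≠ D both at equal distance from B ≠ C forces A + D = B + C;
--   * equilateral triangles: the third vertex is a ±60° rotation;
--   * three vectors as long as e and summing to 3e are all equal to e;
--   * circumradius: a point at distance √r from three centres forces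
--     3r·det(p,q)² = N(p) N(q) N(p - q) for the centres' differences p, q.
-- Three rhombi put vertices 7, 6, 8 at (3,3), (4,2), (5,4).  The unit
-- triangle 3, 4, 5 then has 3 next to (0,0), 5 next to (1,2) and 4 next to
-- (5,4); in either orientation this forces vertex 3 onto vertex 1 or 2,
-- against injectivity.
--
-- As ≈ on
-- the reals is not decidable, case distinctions are made under double
-- negation, which is harmless since the goal is ⊥.

open import Defs
open import Level using (0ℓ)
open import Data.Nat as ℕ using (ℕ; zero; suc)
import Data.Nat.Properties as ℕ
open import Data.Integer as ℤ using (ℤ; +_; -[1+_])
import Data.Integer.Properties as ℤ
open import Data.Fin using (Fin; #_)
import Data.Fin.Properties as Fin
open import Data.Maybe using (Maybe; just; nothing)
open import Data.Product using (_×_; _,_; proj₁; proj₂)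
import Data.Product.Properties as Product
open import Data.Sum using (_⊎_; inj₁; inj₂)
open import Data.Empty using (⊥)
open import Function using (id)
open import Relation.Nullary using (¬_; yes; no)
open import Relation.Nullary.Decidable using (True; toWitness)
open import Relation.Binary.PropositionalEquality as ≡ using (_≡_)
open import Relation.Binary.Structures using (IsTotalOrder)
open import Algebra.Bundles.Raw using (RawRing)
import Algebra.Solver.Ring.AlmostCommutativeRing as ACR
open import Data.List.Membership.DecPropositional (Product.≡-dec (Fin._≟_ {9}) (Fin._≟_ {9}))
  using (_∈?_)

-- It is instantiated
-- over the reals and over the ring solver's polynomial syntax, so each
-- identity below is stated with these names and handed to the solver in
-- the same words.
module Plane {c ℓ} (R : RawRing c ℓ) (num : ℕ → RawRing.Carrier R) where
  open RawRing R

  private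
    infixl 6 _-_
    _-_ : Carrier → Carrier → Carrier
    x - y = x + - y

  infixl 6 _⊕_ _⊖_
  infixr 7 _·_

  Vec2 : Set c
  Vec2 = Carrier × Carrier

  pt : ℕ → ℕ → Vec2
  pt m n = num m , num n

  _⊕_ _⊖_ : Vec2 → Vec2 → Vec2
  (u₁ , u₂) ⊕ (v₁ , v₂) = u₁ + v₁ , u₂ + v₂
  (u₁ , u₂) ⊖ (v₁ , v₂) = u₁ - v₁ , u₂ - v₂

  _·_ : Carrier → Vec2 → Vec2
  t · (u₁ , u₂) = t * u₁ , t * u₂

  ⟪_,_⟫ : Vec2 → Vec2 → Carrier
  ⟪ (u₁ , u₂) , (v₁ , v₂) ⟫ = u₁ * v₁ + u₂ * v₂

  -- The Eisenstein norm: three times the squared length in coordinates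
  -- taken against two unit vectors at 60°.  'polar' is its polar form,
  -- 'det' the determinant, and rot, rot⁻¹ are the rotations by ±60°.
  N : Vec2 → Carrier
  N (u₁ , u₂) = u₁ * u₁ - u₁ * u₂ + u₂ * u₂

  polar : Vec2 → Vec2 → Carrier
  polar (u₁ , u₂) (v₁ , v₂) =
    num 2 * (u₁ * v₁) - u₁ * v₂ - u₂ * v₁ + num 2 * (u₂ * v₂)

  det : Vec2 → Vec2 → Carrier
  det (u₁ , u₂) (v₁ , v₂) = u₁ * v₂ - u₂ * v₁

  rot rot⁻¹ : Vec2 → Vec2
  rot   (u₁ , u₂) = u₁ - u₂ , u₁
  rot⁻¹ (u₁ , u₂) = u₂ , u₂ - u₁

module Proof (ℝ : RealNumbers) where
  open RealNumbers ℝ hiding (zero)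
  open import Algebra.Properties.Semiring.Mult.TCOptimised semiring
    using (×-homo-+; ×1-homo-*; 1+×) renaming (_×_ to _×ᵣ_)
  open import Algebra.Properties.Ring ring
    using (-‿distribˡ-*; -‿distribʳ-*; -‿involutive; -0#≈0#; -‿+-comm)
  open import Algebra.Properties.Group +-group using (x∙y⁻¹≈ε⇒x≈y; x≈y⇒x∙y⁻¹≈ε)
  open import Relation.Binary.Reasoning.Setoid setoid

  -- the natural numbers inside ℝ (num 0 = 0# and num 1 = 1# definitionally)
  num : ℕ → Carrier
  num n = n ×ᵣ 1#

  open Plane rawRing num

  ⟦_⟧ℤ : ℤ → Carrier
  ⟦ + n      ⟧ℤ = num n
  ⟦ -[1+ n ] ⟧ℤ = - num (suc n)

  ⟦-⟧ : ∀ i → ⟦ ℤ.- i ⟧ℤ ≈ - ⟦ i ⟧ℤ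
  ⟦-⟧ (+ zero)  = sym -0#≈0#
  ⟦-⟧ (+ suc n) = refl
  ⟦-⟧ -[1+ n ]  = sym (-‿involutive _)

  sub-shift : ∀ a x y → x - y ≈ (a + x) - (a + y)
  sub-shift a x y = begin
    x - y                    ≈⟨ sym (+-identityˡ _) ⟩
    0# + (x - y)             ≈⟨ +-congʳ (sym (-‿inverseʳ a)) ⟩
    (a - a) + (x - y)        ≈⟨ +-assoc _ _ _ ⟩
    a + (- a + (x - y))      ≈⟨ +-congˡ (sym (+-assoc _ _ _)) ⟩
    a + ((- a + x) - y)      ≈⟨ +-congˡ (+-congʳ (+-comm _ _)) ⟩
    a + ((x - a) - y)        ≈⟨ +-congˡ (+-assoc _ _ _) ⟩
    a + (x + (- a - y))      ≈⟨ sym (+-assoc _ _ _) ⟩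
    (a + x) + (- a - y)      ≈⟨ +-congˡ (-‿+-comm a y) ⟩
    (a + x) - (a + y)        ∎

  ⟦⊖⟧ : ∀ m n → ⟦ m ℤ.⊖ n ⟧ℤ ≈ num m - num n
  ⟦⊖⟧ m       zero    = sym (trans (+-congˡ -0#≈0#) (+-identityʳ _))
  ⟦⊖⟧ zero    (suc n) = sym (+-identityˡ _)
  ⟦⊖⟧ (suc m) (suc n) = begin
    ⟦ suc m ℤ.⊖ suc n ⟧ℤ          ≡⟨ ≡.cong ⟦_⟧ℤ (ℤ.[1+m]⊖[1+n]≡m⊖n m n) ⟩
    ⟦ m ℤ.⊖ n ⟧ℤ                  ≈⟨ ⟦⊖⟧ m n ⟩
    num m - num n                 ≈⟨ sub-shift 1# _ _ ⟩
    (1# + num m) - (1# + num n)   ≈⟨ +-cong (sym (1+× m 1#)) (-‿cong (sym (1+× n 1#))) ⟩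
    num (suc m) - num (suc n)     ∎

  ⟦+⟧ : ∀ i j → ⟦ i ℤ.+ j ⟧ℤ ≈ ⟦ i ⟧ℤ + ⟦ j ⟧ℤ
  ⟦+⟧ (+ m)    (+ n)    = ×-homo-+ 1# m n
  ⟦+⟧ (+ m)    -[1+ n ] = ⟦⊖⟧ m (suc n)
  ⟦+⟧ -[1+ m ] (+ n)    = trans (⟦⊖⟧ n (suc m)) (+-comm _ _)
  ⟦+⟧ -[1+ m ] -[1+ n ] = begin
    - num (suc (suc (m ℕ.+ n)))     ≡⟨ ≡.cong (λ k → - num (suc k)) (≡.sym (ℕ.+-suc m n)) ⟩
    - num (suc m ℕ.+ suc n)         ≈⟨ -‿cong (×-homo-+ 1# (suc m) (suc n)) ⟩
    - (num (suc m) + num (suc n))   ≈⟨ sym (-‿+-comm _ _) ⟩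
    - num (suc m) - num (suc n)     ∎

  ⟦*⟧⁺ : ∀ m j → ⟦ + m ℤ.* j ⟧ℤ ≈ num m * ⟦ j ⟧ℤ
  ⟦*⟧⁺ m (+ n)    = trans (reflexive (≡.cong ⟦_⟧ℤ (≡.sym (ℤ.pos-* m n)))) (×1-homo-* m n)
  ⟦*⟧⁺ m -[1+ n ] = begin
    ⟦ + m ℤ.* ℤ.- + suc n ⟧ℤ        ≡⟨ ≡.cong ⟦_⟧ℤ (≡.sym (ℤ.neg-distribʳ-* (+ m) (+ suc n))) ⟩
    ⟦ ℤ.- (+ m ℤ.* + suc n) ⟧ℤ      ≈⟨ ⟦-⟧ (+ m ℤ.* + suc n) ⟩
    - ⟦ + m ℤ.* + suc n ⟧ℤ          ≈⟨ -‿cong (⟦*⟧⁺ m (+ suc n)) ⟩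
    - (num m * num (suc n))         ≈⟨ -‿distribʳ-* _ _ ⟩
    num m * - num (suc n)           ∎

  ⟦*⟧ : ∀ i j → ⟦ i ℤ.* j ⟧ℤ ≈ ⟦ i ⟧ℤ * ⟦ j ⟧ℤ
  ⟦*⟧ (+ m)    j = ⟦*⟧⁺ m j
  ⟦*⟧ -[1+ m ] j = begin
    ⟦ ℤ.- + suc m ℤ.* j ⟧ℤ          ≡⟨ ≡.cong ⟦_⟧ℤ (≡.sym (ℤ.neg-distribˡ-* (+ suc m) j)) ⟩
    ⟦ ℤ.- (+ suc m ℤ.* j) ⟧ℤ        ≈⟨ ⟦-⟧ (+ suc m ℤ.* j) ⟩
    - ⟦ + suc m ℤ.* j ⟧ℤ            ≈⟨ -‿cong (⟦*⟧⁺ (suc m) j) ⟩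
    - (num (suc m) * ⟦ j ⟧ℤ)        ≈⟨ -‿distribˡ-* _ _ ⟩
    - num (suc m) * ⟦ j ⟧ℤ          ∎

  ℤ⟶ℝ : ℤ.+-*-rawRing ACR.-Raw-AlmostCommutative⟶ ACR.fromCommutativeRing commRing
  ℤ⟶ℝ = record
    { ⟦_⟧ = ⟦_⟧ℤ ; +-homo = ⟦+⟧ ; *-homo = ⟦*⟧ ; -‿homo = ⟦-⟧
    ; 0-homo = refl ; 1-homo = refl }

  ⟦⟧-≟ : ∀ i j → Maybe (⟦ i ⟧ℤ ≈ ⟦ j ⟧ℤ)
  ⟦⟧-≟ i j with i ℤ.≟ j
  ... | yes ≡.refl = just refl
  ... | no _       = nothing

  open import Algebra.Solver.Ring ℤ.+-*-rawRing (ACR.fromCommutativeRing commRing) ℤ⟶ℝ ⟦⟧-≟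
    using (Polynomial; solve; _:=_; _:+_; _:-_; _:*_; :-_; con)

  polynomials : ℕ → RawRing 0ℓ 0ℓ
  polynomials m = record
    { Carrier = Polynomial m ; _≈_ = _≡_ ; _+_ = _:+_ ; _*_ = _:*_ ; -_ = :-_
    ; 0# = con (+ 0) ; 1# = con (+ 1) }

  κ : ∀ {m} → ℕ → Polynomial m
  κ n = con (+ n)

  module S {m : ℕ} = Plane (polynomials m) κ

  DN : Set → Set
  DN A = ¬ ¬ A

  pure : ∀ {A} → A → DN A
  pure a k = k a

  _>>=_ : ∀ {A B} → DN A → (A → DN B) → DN B
  (m >>= f) k = m (λ a → f a k)

  _<$>_ : ∀ {A B} → (A → B) → DN A → DN B
  f <$> m = m >>= λ a → pure (f a)

  module ≤ = IsTotalOrder isTotalOrder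

  from-diff : ∀ {x y} → x - y ≈ 0# → x ≈ y
  from-diff = x∙y⁻¹≈ε⇒x≈y _ _

  to-diff : ∀ {x y} → x ≈ y → x - y ≈ 0#
  to-diff = x≈y⇒x∙y⁻¹≈ε

  equal-diff : ∀ {x y r} → x ≈ r → y ≈ r → x - y ≈ 0#
  equal-diff x≈r y≈r = to-diff (trans x≈r (sym y≈r))

  +-vanish : ∀ {x y} → x ≈ 0# → y ≈ 0# → x + y ≈ 0#
  +-vanish x≈0 y≈0 = trans (+-cong x≈0 y≈0) (+-identityʳ 0#)

  diff-vanish : ∀ {x y} → x ≈ 0# → y ≈ 0# → x - y ≈ 0#
  diff-vanish x≈0 y≈0 = +-vanish x≈0 (trans (-‿cong y≈0) -0#≈0#)

  *-vanishˡ : ∀ {x} y → x ≈ 0# → x * y ≈ 0#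
  *-vanishˡ y x≈0 = trans (*-congʳ x≈0) (zeroˡ y)

  *-vanishʳ : ∀ x {y} → y ≈ 0# → x * y ≈ 0#
  *-vanishʳ x y≈0 = trans (*-congˡ y≈0) (zeroʳ x)

  cancel : ∀ {x y} → x * y ≈ 0# → ¬ x ≈ 0# → y ≈ 0#
  cancel {x} {y} xy≈0 x≉0 with inverse x x≉0
  ... | x⁻¹ , xx⁻¹≈1 = begin
    y                ≈⟨ sym (*-identityˡ y) ⟩
    1# * y           ≈⟨ *-congʳ (sym xx⁻¹≈1) ⟩
    (x * x⁻¹) * y    ≈⟨ solve 3 (λ x x⁻¹ y → (x :* x⁻¹) :* y := x⁻¹ :* (x :* y)) refl x x⁻¹ y ⟩
    x⁻¹ * (x * y)    ≈⟨ *-congˡ xy≈0 ⟩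
    x⁻¹ * 0#         ≈⟨ zeroʳ x⁻¹ ⟩
    0#               ∎

  zero-product : ∀ {x y} → x * y ≈ 0# → DN (x ≈ 0# ⊎ y ≈ 0#)
  zero-product xy≈0 k = k (inj₂ (cancel xy≈0 (λ x≈0 → k (inj₁ x≈0))))

  square-zero : ∀ {x} → x * x ≈ 0# → DN (x ≈ 0#)
  square-zero xx≈0 k = k (cancel xx≈0 k)

  neg-nonneg : ∀ {x} → x ≤ 0# → 0# ≤ (- x)
  neg-nonneg {x} x≤0 =
    ≤.≤-respˡ-≈ (-‿inverseʳ x) (≤.≤-respʳ-≈ (+-identityˡ (- x)) (+-mono-≤ (- x) x≤0))

  square-nonneg : ∀ x → 0# ≤ (x * x)
  square-nonneg x with ≤.total 0# x
  ... | inj₁ 0≤x = *-nonneg 0≤x 0≤x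
  ... | inj₂ x≤0 = ≤.≤-respʳ-≈ (solve 1 (λ x → (:- x) :* (:- x) := x :* x) refl x)
                               (*-nonneg (neg-nonneg x≤0) (neg-nonneg x≤0))

  +-nonneg : ∀ {x y} → 0# ≤ x → 0# ≤ y → 0# ≤ (x + y)
  +-nonneg {x} {y} 0≤x 0≤y =
    ≤.trans (≤.≤-respʳ-≈ (sym (+-identityˡ y)) 0≤y) (+-mono-≤ y 0≤x)

  half-nonneg : ∀ {x} → 0# ≤ (x + x) → 0# ≤ x
  half-nonneg {x} 0≤2x with ≤.total 0# x
  ... | inj₁ 0≤x = 0≤x
  ... | inj₂ x≤0 = ≤.trans 0≤2x (≤.≤-respʳ-≈ (+-identityˡ x) (+-mono-≤ x x≤0))

  nonneg-sum-zero : ∀ {x y} → 0# ≤ x → 0# ≤ y → x + y ≈ 0# → x ≈ 0# × y ≈ 0#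
  nonneg-sum-zero {x} {y} 0≤x 0≤y x+y≈0 = below 0≤x 0≤y x+y≈0 , below 0≤y 0≤x (trans (+-comm y x) x+y≈0)
    where
    below : ∀ {a b} → 0# ≤ a → 0# ≤ b → a + b ≈ 0# → a ≈ 0#
    below {a} {b} 0≤a 0≤b a+b≈0 =
      ≤.antisym (≤.≤-respʳ-≈ a+b≈0 a≤a+b) 0≤a
      where
      a≤a+b : a ≤ (a + b)
      a≤a+b = ≤.≤-respʳ-≈ (+-comm b a) (≤.≤-respˡ-≈ (+-identityˡ a) (+-mono-≤ a 0≤b))

  0≤1 : 0# ≤ 1#
  0≤1 = ≤.≤-respʳ-≈ (*-identityˡ 1#) (square-nonneg 1#)

  num-nonneg : ∀ n → 0# ≤ num n
  num-nonneg zero          = ≤.refl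
  num-nonneg (suc zero)    = 0≤1
  num-nonneg (suc (suc n)) = +-nonneg (num-nonneg (suc n)) 0≤1

  num-nonzero : ∀ n → ¬ num (suc n) ≈ 0#
  num-nonzero zero    1≈0   = 0≉1 (sym 1≈0)
  num-nonzero (suc n) n+1≈0 = 0≉1 (sym (proj₂ (nonneg-sum-zero (num-nonneg (suc n)) 0≤1 n+1≈0)))

  offset-nonzero : ∀ {x} n → 0# ≤ x → ¬ x + num (suc n) ≈ 0#
  offset-nonzero n 0≤x h = num-nonzero n (proj₂ (nonneg-sum-zero 0≤x (num-nonneg (suc n)) h))

  infix 4 _≈ᵥ_
  _≈ᵥ_ : Vec2 → Vec2 → Set
  u ≈ᵥ v = (proj₁ u ≈ proj₁ v) × (proj₂ u ≈ proj₂ v)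

  ≈ᵥ-refl : ∀ {u} → u ≈ᵥ u
  ≈ᵥ-refl = refl , refl

  ≈ᵥ-sym : ∀ {u v} → u ≈ᵥ v → v ≈ᵥ u
  ≈ᵥ-sym (e₁ , e₂) = sym e₁ , sym e₂

  ≈ᵥ-trans : ∀ {u v w} → u ≈ᵥ v → v ≈ᵥ w → u ≈ᵥ w
  ≈ᵥ-trans (e₁ , e₂) (f₁ , f₂) = trans e₁ f₁ , trans e₂ f₂

  ⊕-cong : ∀ {u u′ v v′} → u ≈ᵥ u′ → v ≈ᵥ v′ → u ⊕ v ≈ᵥ u′ ⊕ v′
  ⊕-cong (e₁ , e₂) (f₁ , f₂) = +-cong e₁ f₁ , +-cong e₂ f₂

  ⊖-cong : ∀ {u u′ v v′} → u ≈ᵥ u′ → v ≈ᵥ v′ → u ⊖ v ≈ᵥ u′ ⊖ v′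
  ⊖-cong (e₁ , e₂) (f₁ , f₂) = +-cong e₁ (-‿cong f₁) , +-cong e₂ (-‿cong f₂)

  ·-cong : ∀ {s t u v} → s ≈ t → u ≈ᵥ v → s · u ≈ᵥ t · v
  ·-cong s≈t (e₁ , e₂) = *-cong s≈t e₁ , *-cong s≈t e₂

  rot⁻¹-cong : ∀ {u v} → u ≈ᵥ v → rot⁻¹ u ≈ᵥ rot⁻¹ v
  rot⁻¹-cong (e₁ , e₂) = e₂ , +-cong e₂ (-‿cong e₁)

  N-cong : ∀ {u v} → u ≈ᵥ v → N u ≈ N v
  N-cong (e₁ , e₂) = +-cong (+-cong (*-cong e₁ e₁) (-‿cong (*-cong e₁ e₂))) (*-cong e₂ e₂)

  polar-cong : ∀ {u u′ v v′} → u ≈ᵥ u′ → v ≈ᵥ v′ → polar u v ≈ polar u′ v′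
  polar-cong (e₁ , e₂) (f₁ , f₂) =
    +-cong (+-cong (+-cong (*-congˡ (*-cong e₁ f₁)) (-‿cong (*-cong e₁ f₂))) (-‿cong (*-cong e₂ f₁)))
           (*-congˡ (*-cong e₂ f₂))

  ⊖-solve : ∀ {u x t} → u ⊖ x ≈ᵥ t → u ≈ᵥ x ⊕ t
  ⊖-solve {u₁ , u₂} {x₁ , x₂} u-x≈t =
    ≈ᵥ-trans (coordinate u₁ x₁ , coordinate u₂ x₂) (⊕-cong ≈ᵥ-refl u-x≈t)
    where
    coordinate : ∀ u x → u ≈ x + (u - x)
    coordinate = solve 2 (λ u x → u := x :+ (u :- x)) refl

  ⊖-⊖ : ∀ x v r → x ⊖ (v ⊖ r) ≈ᵥ x ⊕ r ⊖ v
  ⊖-⊖ (x₁ , x₂) (v₁ , v₂) (r₁ , r₂) = coordinate x₁ v₁ r₁ , coordinate x₂ v₂ r₂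
    where
    coordinate : ∀ x v r → x - (v - r) ≈ x + r - v
    coordinate = solve 3 (λ x v r → x :- (v :- r) := x :+ r :- v) refl

  lattice-step : ∀ a₁ a₂ b₁ b₂ c₁ c₂ d₁ d₂ →
                 a₁ ℕ.+ b₁ ≡ c₁ ℕ.+ d₁ → a₂ ℕ.+ b₂ ≡ c₂ ℕ.+ d₂ →
                 pt a₁ a₂ ⊕ pt b₁ b₂ ⊖ pt c₁ c₂ ≈ᵥ pt d₁ d₂
  lattice-step a₁ a₂ b₁ b₂ c₁ c₂ d₁ d₂ e₁ e₂ = step a₁ b₁ c₁ d₁ e₁ , step a₂ b₂ c₂ d₂ e₂
    where
    step : ∀ a b c d → a ℕ.+ b ≡ c ℕ.+ d → num a + num b - num c ≈ num d
    step a b c d a+b≡c+d = begin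
      num a + num b - num c        ≈⟨ +-congʳ (sym (×-homo-+ 1# a b)) ⟩
      num (a ℕ.+ b) - num c        ≡⟨ ≡.cong (λ k → num k - num c) a+b≡c+d ⟩
      num (c ℕ.+ d) - num c        ≈⟨ +-congʳ (×-homo-+ 1# c d) ⟩
      num c + num d - num c        ≈⟨ solve 2 (λ c d → c :+ d :- c := d) refl (num c) (num d) ⟩
      num d                        ∎

  N-twice : ∀ u → N u + N u ≈
    proj₁ u * proj₁ u + (proj₂ u * proj₂ u + (proj₁ u - proj₂ u) * (proj₁ u - proj₂ u))
  N-twice (u₁ , u₂) = solve 2 (λ u₁ u₂ →
    S.N (u₁ , u₂) :+ S.N (u₁ , u₂) := u₁ :* u₁ :+ (u₂ :* u₂ :+ (u₁ :- u₂) :* (u₁ :- u₂)))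
    refl u₁ u₂

  N-nonneg : ∀ u → 0# ≤ N u
  N-nonneg (u₁ , u₂) = half-nonneg (≤.≤-respʳ-≈ (sym (N-twice (u₁ , u₂)))
    (+-nonneg (square-nonneg u₁) (+-nonneg (square-nonneg u₂) (square-nonneg (u₁ - u₂)))))

  N-definite : ∀ u v → N (u ⊖ v) ≈ 0# → DN (u ≈ᵥ v)
  N-definite u v N≈0 = do
      d₁≈0 ← square-zero d₁²≈0
      d₂≈0 ← square-zero d₂²≈0
      pure (from-diff d₁≈0 , from-diff d₂≈0)
    where
    d₁ d₂ : Carrier
    d₁ = proj₁ (u ⊖ v)
    d₂ = proj₂ (u ⊖ v)
    sum≈0 : d₁ * d₁ + (d₂ * d₂ + (d₁ - d₂) * (d₁ - d₂)) ≈ 0#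
    sum≈0 = trans (sym (N-twice (u ⊖ v))) (+-vanish N≈0 N≈0)
    split : d₁ * d₁ ≈ 0# × d₂ * d₂ + (d₁ - d₂) * (d₁ - d₂) ≈ 0#
    split = nonneg-sum-zero (square-nonneg d₁) (+-nonneg (square-nonneg d₂) (square-nonneg (d₁ - d₂))) sum≈0
    d₁²≈0 : d₁ * d₁ ≈ 0#
    d₁²≈0 = proj₁ split
    d₂²≈0 : d₂ * d₂ ≈ 0#
    d₂²≈0 = proj₁ (nonneg-sum-zero (square-nonneg d₂) (square-nonneg (d₁ - d₂)) (proj₂ split))

  N-sym : ∀ u v → N (u ⊖ v) ≈ N (v ⊖ u)
  N-sym (u₁ , u₂) (v₁ , v₂) = solve 4 (λ u₁ u₂ v₁ v₂ →
    S.N ((u₁ , u₂) S.⊖ (v₁ , v₂)) := S.N ((v₁ , v₂) S.⊖ (u₁ , u₂))) refl u₁ u₂ v₁ v₂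

  N-rot : ∀ u → N (rot u) ≈ N u
  N-rot (u₁ , u₂) = solve 2 (λ u₁ u₂ → S.N (S.rot (u₁ , u₂)) := S.N (u₁ , u₂)) refl u₁ u₂

  N-apart : ∀ u v → ¬ u ≈ᵥ v → ¬ N (u ⊖ v) ≈ 0#
  N-apart u v u≉v N≈0 = N-definite u v N≈0 u≉v

  rhombus-polar₁ : ∀ A B C D →
    polar (A ⊖ D) (C ⊖ B) ≈ (N (A ⊖ B) - N (A ⊖ C)) - (N (D ⊖ B) - N (D ⊖ C))
  rhombus-polar₁ (a₁ , a₂) (b₁ , b₂) (c₁ , c₂) (d₁ , d₂) = solve 8 (λ a₁ a₂ b₁ b₂ c₁ c₂ d₁ d₂ →
    let A = a₁ , a₂ ; B = b₁ , b₂ ; C = c₁ , c₂ ; D = d₁ , d₂ in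
    S.polar (A S.⊖ D) (C S.⊖ B) := (S.N (A S.⊖ B) :- S.N (A S.⊖ C)) :- (S.N (D S.⊖ B) :- S.N (D S.⊖ C)))
    refl a₁ a₂ b₁ b₂ c₁ c₂ d₁ d₂

  rhombus-polar₂ : ∀ A B C D →
    polar (A ⊕ D ⊖ (B ⊕ C)) (C ⊖ B) ≈ (N (A ⊖ B) - N (A ⊖ C)) + (N (D ⊖ B) - N (D ⊖ C))
  rhombus-polar₂ (a₁ , a₂) (b₁ , b₂) (c₁ , c₂) (d₁ , d₂) = solve 8 (λ a₁ a₂ b₁ b₂ c₁ c₂ d₁ d₂ →
    let A = a₁ , a₂ ; B = b₁ , b₂ ; C = c₁ , c₂ ; D = d₁ , d₂ in
    S.polar (A S.⊕ D S.⊖ (B S.⊕ C)) (C S.⊖ B) := (S.N (A S.⊖ B) :- S.N (A S.⊖ C)) :+ (S.N (D S.⊖ B) :- S.N (D S.⊖ C)))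
    refl a₁ a₂ b₁ b₂ c₁ c₂ d₁ d₂

  rhombus-polar₃ : ∀ A B C D →
    polar (A ⊖ D) (A ⊕ D ⊖ (B ⊕ C)) ≈ (N (A ⊖ B) - N (D ⊖ B)) + (N (A ⊖ C) - N (D ⊖ C))
  rhombus-polar₃ (a₁ , a₂) (b₁ , b₂) (c₁ , c₂) (d₁ , d₂) = solve 8 (λ a₁ a₂ b₁ b₂ c₁ c₂ d₁ d₂ →
    let A = a₁ , a₂ ; B = b₁ , b₂ ; C = c₁ , c₂ ; D = d₁ , d₂ in
    S.polar (A S.⊖ D) (A S.⊕ D S.⊖ (B S.⊕ C)) := (S.N (A S.⊖ B) :- S.N (D S.⊖ B)) :+ (S.N (A S.⊖ C) :- S.N (D S.⊖ C)))
    refl a₁ a₂ b₁ b₂ c₁ c₂ d₁ d₂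

  -- two vectors polar-orthogonal to a nonzero e are parallel
  det-via-polar : ∀ p q e → num 2 * N e * det p q ≈ polar p e * det e q + polar q e * det p e
  det-via-polar (p₁ , p₂) (q₁ , q₂) (e₁ , e₂) = solve 6 (λ p₁ p₂ q₁ q₂ e₁ e₂ →
    let p = p₁ , p₂ ; q = q₁ , q₂ ; e = e₁ , e₂ in
    κ 2 :* S.N e :* S.det p q := S.polar p e :* S.det e q :+ S.polar q e :* S.det p e)
    refl p₁ p₂ q₁ q₂ e₁ e₂

  lagrange : ∀ p q → num 4 * (N p * N q) ≈ polar p q * polar p q + num 3 * (det p q * det p q)
  lagrange (p₁ , p₂) (q₁ , q₂) = solve 4 (λ p₁ p₂ q₁ q₂ →
    let p = p₁ , p₂ ; q = q₁ , q₂ in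
    κ 4 :* (S.N p :* S.N q) := S.polar p q :* S.polar p q :+ κ 3 :* (S.det p q :* S.det p q))
    refl p₁ p₂ q₁ q₂

  rhombus-diagonal : ∀ A B C D → D ⊖ (B ⊕ C ⊖ A) ≈ᵥ A ⊕ D ⊖ (B ⊕ C)
  rhombus-diagonal (a₁ , a₂) (b₁ , b₂) (c₁ , c₂) (d₁ , d₂) =
    coordinate d₁ b₁ c₁ a₁ , coordinate d₂ b₂ c₂ a₂
    where
    coordinate : ∀ d b c a → d - (b + c - a) ≈ a + d - (b + c)
    coordinate = solve 4 (λ d b c a → d :- (b :+ c :- a) := a :+ d :- (b :+ c)) refl

  rhombus : ∀ {r} A B C D → N (A ⊖ B) ≈ r → N (A ⊖ C) ≈ r → N (D ⊖ B) ≈ r → N (D ⊖ C) ≈ r →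
            ¬ B ≈ᵥ C → ¬ A ≈ᵥ D → DN (D ≈ᵥ B ⊕ C ⊖ A)
  rhombus A B C D AB AC DB DC B≉C A≉D =
    N-definite D (B ⊕ C ⊖ A) (trans (N-cong (rhombus-diagonal A B C D)) Nq≈0)
    where
    p q e : Vec2
    p = A ⊖ D
    q = A ⊕ D ⊖ (B ⊕ C)
    e = C ⊖ B
    pe≈0 : polar p e ≈ 0#
    pe≈0 = trans (rhombus-polar₁ A B C D) (diff-vanish (equal-diff AB AC) (equal-diff DB DC))
    qe≈0 : polar q e ≈ 0#
    qe≈0 = trans (rhombus-polar₂ A B C D) (+-vanish (equal-diff AB AC) (equal-diff DB DC))
    pq≈0 : polar p q ≈ 0#
    pq≈0 = trans (rhombus-polar₃ A B C D) (+-vanish (equal-diff AB DB) (equal-diff AC DC))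
    2Ne≉0 : ¬ num 2 * N e ≈ 0#
    2Ne≉0 2Ne≈0 = N-apart C B (λ C≈B → B≉C (≈ᵥ-sym C≈B)) (cancel 2Ne≈0 (num-nonzero 1))
    -- p and q are both orthogonal to e, so parallel ...
    det≈0 : det p q ≈ 0#
    det≈0 = cancel (trans (det-via-polar p q e) (+-vanish (*-vanishˡ _ pe≈0) (*-vanishˡ _ qe≈0))) 2Ne≉0
    -- ... and orthogonal to each other, so one vanishes; p does not.
    Nq≈0 : N q ≈ 0#
    Nq≈0 = cancel (cancel (trans (lagrange p q) (+-vanish (*-vanishˡ _ pq≈0)
                                                          (*-vanishʳ (num 3) (*-vanishˡ _ det≈0))))
                          (num-nonzero 3))
                  (N-apart A D A≉D)

  equilateral-identity : ∀ v w →
    N (v ⊖ rot w) * N (v ⊖ rot⁻¹ w) ≈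
    N v * (N v - N w) + N w * (N w - N (v ⊖ w)) + N (v ⊖ w) * (N (v ⊖ w) - N v)
  equilateral-identity (v₁ , v₂) (w₁ , w₂) = solve 4 (λ v₁ v₂ w₁ w₂ →
    let v = v₁ , v₂ ; w = w₁ , w₂ in
    S.N (v S.⊖ S.rot w) :* S.N (v S.⊖ S.rot⁻¹ w) :=
    S.N v :* (S.N v :- S.N w) :+ S.N w :* (S.N w :- S.N (v S.⊖ w)) :+ S.N (v S.⊖ w) :* (S.N (v S.⊖ w) :- S.N v))
    refl v₁ v₂ w₁ w₂

  equilateral : ∀ {r} v w → N v ≈ r → N w ≈ r → N (v ⊖ w) ≈ r → DN (v ≈ᵥ rot w ⊎ v ≈ᵥ rot⁻¹ w)
  equilateral v w Nv Nw Nv-w = zero-product (trans (equilateral-identity v w) sides-equal) >>= λ where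
      (inj₁ N≈0) → inj₁ <$> N-definite v (rot w) N≈0
      (inj₂ N≈0) → inj₂ <$> N-definite v (rot⁻¹ w) N≈0
    where
    sides-equal : N v * (N v - N w) + N w * (N w - N (v ⊖ w)) + N (v ⊖ w) * (N (v ⊖ w) - N v) ≈ 0#
    sides-equal = +-vanish (+-vanish (*-vanishʳ _ (equal-diff Nv Nw)) (*-vanishʳ _ (equal-diff Nw Nv-w)))
                           (*-vanishʳ _ (equal-diff Nv-w Nv))

  -- Equality in the triangle inequality: three vectors of the same length
  -- as e that add up to 3e are all equal to e.

  three-equal-identity : ∀ a b c e →
    N (a ⊖ e) + N (b ⊖ e) + N (c ⊖ e) ≈
    (N a - N e) + (N b - N e) + (N c - N e) + (polar (num 3 · e) e - polar (a ⊕ b ⊕ c) e)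
  three-equal-identity (a₁ , a₂) (b₁ , b₂) (c₁ , c₂) (e₁ , e₂) = solve 8 (λ a₁ a₂ b₁ b₂ c₁ c₂ e₁ e₂ →
    let a = a₁ , a₂ ; b = b₁ , b₂ ; c = c₁ , c₂ ; e = e₁ , e₂ in
    S.N (a S.⊖ e) :+ S.N (b S.⊖ e) :+ S.N (c S.⊖ e) :=
    (S.N a :- S.N e) :+ (S.N b :- S.N e) :+ (S.N c :- S.N e) :+ (S.polar (κ 3 S.· e) e :- S.polar (a S.⊕ b S.⊕ c) e))
    refl a₁ a₂ b₁ b₂ c₁ c₂ e₁ e₂

  three-equal : ∀ {r} a b c e → N a ≈ r → N b ≈ r → N c ≈ r → N e ≈ r →
                a ⊕ b ⊕ c ≈ᵥ num 3 · e → DN (a ≈ᵥ e)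
  three-equal a b c e Na Nb Nc Ne sum≈3e =
    N-definite a e (proj₁ (nonneg-sum-zero (N-nonneg (a ⊖ e)) (N-nonneg (b ⊖ e)) first-two≈0))
    where
    total≈0 : N (a ⊖ e) + N (b ⊖ e) + N (c ⊖ e) ≈ 0#
    total≈0 = trans (three-equal-identity a b c e)
      (+-vanish (+-vanish (+-vanish (equal-diff Na Ne) (equal-diff Nb Ne)) (equal-diff Nc Ne))
                (to-diff (polar-cong (≈ᵥ-sym sum≈3e) ≈ᵥ-refl)))
    first-two≈0 : N (a ⊖ e) + N (b ⊖ e) ≈ 0#
    first-two≈0 = proj₁ (nonneg-sum-zero (+-nonneg (N-nonneg (a ⊖ e)) (N-nonneg (b ⊖ e)))
                                         (N-nonneg (c ⊖ e)) total≈0)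

  polarisation : ∀ x p → polar x p ≈ N x - N (x ⊖ p) + N p
  polarisation (x₁ , x₂) (p₁ , p₂) = solve 4 (λ x₁ x₂ p₁ p₂ →
    let x = x₁ , x₂ ; p = p₁ , p₂ in
    S.polar x p := S.N x :- S.N (x S.⊖ p) :+ S.N p)
    refl x₁ x₂ p₁ p₂

  -- Cramer's rule for x from its polar products with p and q, squared
  cramer-squared : ∀ x p q → num 3 * N x * (det p q * det p q) ≈ N (polar x p · q ⊖ polar x q · p)
  cramer-squared (x₁ , x₂) (p₁ , p₂) (q₁ , q₂) = solve 6 (λ x₁ x₂ p₁ p₂ q₁ q₂ →
    let x = x₁ , x₂ ; p = p₁ , p₂ ; q = q₁ , q₂ in
    κ 3 :* S.N x :* (S.det p q :* S.det p q) := S.N (S.polar x p S.· q S.⊖ S.polar x q S.· p))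
    refl x₁ x₂ p₁ p₂ q₁ q₂

  rescaled-difference : ∀ p q → N (N p · q ⊖ N q · p) ≈ N p * N q * N (p ⊖ q)
  rescaled-difference (p₁ , p₂) (q₁ , q₂) = solve 4 (λ p₁ p₂ q₁ q₂ →
    let p = p₁ , p₂ ; q = q₁ , q₂ in
    S.N (S.N p S.· q S.⊖ S.N q S.· p) := S.N p :* S.N q :* S.N (p S.⊖ q))
    refl p₁ p₂ q₁ q₂

  ⊖-translate : ∀ x c c₀ → (x ⊖ c₀) ⊖ (c ⊖ c₀) ≈ᵥ x ⊖ c
  ⊖-translate (x₁ , x₂) (c₁ , c₂) (d₁ , d₂) = coordinate x₁ c₁ d₁ , coordinate x₂ c₂ d₂
    where
    coordinate : ∀ x c d → (x - d) - (c - d) ≈ x - c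
    coordinate = solve 3 (λ x c d → (x :- d) :- (c :- d) := x :- c) refl

  circumradius : ∀ {r} x c₀ c₁ c₂ → N (x ⊖ c₀) ≈ r → N (x ⊖ c₁) ≈ r → N (x ⊖ c₂) ≈ r →
                 num 3 * r * (det (c₁ ⊖ c₀) (c₂ ⊖ c₀) * det (c₁ ⊖ c₀) (c₂ ⊖ c₀)) ≈
                 N (c₁ ⊖ c₀) * N (c₂ ⊖ c₀) * N (c₁ ⊖ c₂)
  circumradius {r} x c₀ c₁ c₂ x₀ x₁ x₂ = begin
    num 3 * r * (det p q * det p q)        ≈⟨ *-congʳ (*-congˡ (sym x₀)) ⟩
    num 3 * N y * (det p q * det p q)      ≈⟨ cramer-squared y p q ⟩
    N (polar y p · q ⊖ polar y q · p)
        ≈⟨ N-cong (⊖-cong (·-cong (polar-to x₁) ≈ᵥ-refl) (·-cong (polar-to x₂) ≈ᵥ-refl)) ⟩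
    N (N p · q ⊖ N q · p)                  ≈⟨ rescaled-difference p q ⟩
    N p * N q * N (p ⊖ q)                  ≈⟨ *-congˡ (N-cong (⊖-translate c₁ c₂ c₀)) ⟩
    N p * N q * N (c₁ ⊖ c₂)                ∎
    where
    y p q : Vec2
    y = x ⊖ c₀
    p = c₁ ⊖ c₀
    q = c₂ ⊖ c₀
    polar-to : ∀ {c} → N (x ⊖ c) ≈ r → polar y (c ⊖ c₀) ≈ N (c ⊖ c₀)
    polar-to {c} xc = trans (polarisation y (c ⊖ c₀))
      (trans (+-congʳ (equal-diff x₀ (trans (N-cong (⊖-translate x c c₀)) xc))) (+-identityˡ _))

  -- The defects of |a| = 1, |b| = 1 and 2⟨a,b⟩ = 1 (a, b span a unit
  -- triangle), weighted as they enter Gram's identity below.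
  gram-defect : Vec2 → Vec2 → Vec2 → Carrier
  gram-defect d a b =
    (⟪ a , a ⟫ - 1#) * (num 4 * (⟪ d , b ⟫ * ⟪ d , b ⟫ - ⟪ b , b ⟫ * ⟪ d , d ⟫))
    + (⟪ b , b ⟫ - 1#) * (num 4 * (⟪ d , a ⟫ * ⟪ d , a ⟫ - ⟪ d , d ⟫))
    + (num 2 * ⟪ a , b ⟫ - 1#)
      * ((1# + num 2 * ⟪ a , b ⟫) * ⟪ d , d ⟫ - num 4 * (⟪ d , a ⟫ * ⟪ d , b ⟫))

  gram-certificate : ∀ d a b →
    num 3 * ⟪ d , d ⟫ ≈ N (num 2 * ⟪ d , a ⟫ , num 2 * ⟪ d , b ⟫) + gram-defect d a b
  gram-certificate (d₁ , d₂) (a₁ , a₂) (b₁ , b₂) = solve 6 (λ d₁ d₂ a₁ a₂ b₁ b₂ →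
    let d = d₁ , d₂ ; a = a₁ , a₂ ; b = b₁ , b₂ in
    κ 3 :* S.⟪ d , d ⟫ := S.N (κ 2 :* S.⟪ d , a ⟫ , κ 2 :* S.⟪ d , b ⟫)
      :+ ((S.⟪ a , a ⟫ :- κ 1) :* (κ 4 :* (S.⟪ d , b ⟫ :* S.⟪ d , b ⟫ :- S.⟪ b , b ⟫ :* S.⟪ d , d ⟫))
          :+ (S.⟪ b , b ⟫ :- κ 1) :* (κ 4 :* (S.⟪ d , a ⟫ :* S.⟪ d , a ⟫ :- S.⟪ d , d ⟫))
          :+ (κ 2 :* S.⟪ a , b ⟫ :- κ 1)
             :* ((κ 1 :+ κ 2 :* S.⟪ a , b ⟫) :* S.⟪ d , d ⟫ :- κ 4 :* (S.⟪ d , a ⟫ :* S.⟪ d , b ⟫))))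
    refl d₁ d₂ a₁ a₂ b₁ b₂

  inner-by-distances : ∀ O A B →
    num 2 * ⟪ A ⊖ O , B ⊖ O ⟫ ≈ dist² ℝ O A + dist² ℝ O B - dist² ℝ A B
  inner-by-distances (o₁ , o₂) (a₁ , a₂) (b₁ , b₂) = solve 6 (λ o₁ o₂ a₁ a₂ b₁ b₂ →
    let O = o₁ , o₂ ; A = a₁ , a₂ ; B = b₁ , b₂ in
    κ 2 :* S.⟪ A S.⊖ O , B S.⊖ O ⟫ :=
    S.⟪ O S.⊖ A , O S.⊖ A ⟫ :+ S.⟪ O S.⊖ B , O S.⊖ B ⟫ :- S.⟪ A S.⊖ B , A S.⊖ B ⟫)
    refl o₁ o₂ a₁ a₂ b₁ b₂

  inner-difference : ∀ p q o u →
    num 2 * ⟪ p ⊖ o , u ⟫ - num 2 * ⟪ q ⊖ o , u ⟫ ≈ num 2 * ⟪ p ⊖ q , u ⟫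
  inner-difference (p₁ , p₂) (q₁ , q₂) (o₁ , o₂) (u₁ , u₂) = solve 8 (λ p₁ p₂ q₁ q₂ o₁ o₂ u₁ u₂ →
    let p = p₁ , p₂ ; q = q₁ , q₂ ; o = o₁ , o₂ ; u = u₁ , u₂ in
    κ 2 :* S.⟪ p S.⊖ o , u ⟫ :- κ 2 :* S.⟪ q S.⊖ o , u ⟫ := κ 2 :* S.⟪ p S.⊖ q , u ⟫)
    refl p₁ p₂ q₁ q₂ o₁ o₂ u₁ u₂

  inner-origin : ∀ o u → num 2 * ⟪ o ⊖ o , u ⟫ ≈ 0#
  inner-origin (o₁ , o₂) (u₁ , u₂) = solve 4 (λ o₁ o₂ u₁ u₂ →
    κ 2 :* S.⟪ (o₁ , o₂) S.⊖ (o₁ , o₂) , (u₁ , u₂) ⟫ := κ 0) refl o₁ o₂ u₁ u₂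

  dist²-sym : ∀ p q → dist² ℝ p q ≈ dist² ℝ q p
  dist²-sym (p₁ , p₂) (q₁ , q₂) = solve 4 (λ p₁ p₂ q₁ q₂ →
    S.⟪ (p₁ , p₂) S.⊖ (q₁ , q₂) , (p₁ , p₂) S.⊖ (q₁ , q₂) ⟫ :=
    S.⟪ (q₁ , q₂) S.⊖ (p₁ , p₂) , (q₁ , q₂) S.⊖ (p₁ , p₂) ⟫) refl p₁ p₂ q₁ q₂

  dist²-definite : ∀ p q → dist² ℝ p q ≈ 0# → DN (p ≈ᵥ q)
  dist²-definite p q d²≈0 = do
      d₁≈0 ← square-zero (proj₁ squares≈0)
      d₂≈0 ← square-zero (proj₂ squares≈0)
      pure (from-diff d₁≈0 , from-diff d₂≈0)
    where
    d₁ d₂ : Carrier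
    d₁ = proj₁ (p ⊖ q)
    d₂ = proj₂ (p ⊖ q)
    squares≈0 : d₁ * d₁ ≈ 0# × d₂ * d₂ ≈ 0#
    squares≈0 = nonneg-sum-zero (square-nonneg d₁) (square-nonneg d₂) d²≈0

  N-self : ∀ u → N (u ⊖ u) ≈ 0#
  N-self (u₁ , u₂) = solve 2 (λ u₁ u₂ → S.N ((u₁ , u₂) S.⊖ (u₁ , u₂)) := κ 0) refl u₁ u₂

  v₀ v₁ v₂ v₆ v₇ v₈ : Vec2
  v₀ = pt 0 0
  v₁ = pt 2 1
  v₂ = pt 1 2
  v₆ = pt 4 2
  v₇ = pt 3 3
  v₈ = pt 5 4

  module EisensteinCoordinates (O A B : Vec2)
      (OA : dist² ℝ O A ≈ 1#) (OB : dist² ℝ O B ≈ 1#) (AB : dist² ℝ A B ≈ 1#) where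

    a b : Vec2
    a = A ⊖ O
    b = B ⊖ O

    E : Vec2 → Vec2
    E p = num 2 * ⟪ p ⊖ O , a ⟫ , num 2 * ⟪ p ⊖ O , b ⟫

    a·a : ⟪ a , a ⟫ ≈ 1#
    a·a = trans (dist²-sym A O) OA

    b·b : ⟪ b , b ⟫ ≈ 1#
    b·b = trans (dist²-sym B O) OB

    2a·b : num 2 * ⟪ a , b ⟫ ≈ 1#
    2a·b = trans (inner-by-distances O A B)
      (trans (+-cong (+-cong OA OB) (-‿cong AB)) (solve 0 (κ 1 :+ κ 1 :- κ 1 := κ 1) refl))

    isometry : ∀ p q → num 3 * dist² ℝ p q ≈ N (E p ⊖ E q)
    isometry p q = begin
      num 3 * dist² ℝ p q                              ≈⟨ gram-certificate (p ⊖ q) a b ⟩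
      N (num 2 * ⟪ p ⊖ q , a ⟫ , num 2 * ⟪ p ⊖ q , b ⟫) + gram-defect (p ⊖ q) a b
                                                       ≈⟨ +-congˡ defect≈0 ⟩
      N (num 2 * ⟪ p ⊖ q , a ⟫ , num 2 * ⟪ p ⊖ q , b ⟫) + 0#
                                                       ≈⟨ +-identityʳ _ ⟩
      N (num 2 * ⟪ p ⊖ q , a ⟫ , num 2 * ⟪ p ⊖ q , b ⟫)
                  ≈⟨ N-cong (≈ᵥ-sym (inner-difference p q O a , inner-difference p q O b)) ⟩
      N (E p ⊖ E q)                                    ∎
      where
      defect≈0 : gram-defect (p ⊖ q) a b ≈ 0#
      defect≈0 = +-vanish (+-vanish (*-vanishˡ _ (to-diff a·a)) (*-vanishˡ _ (to-diff b·b)))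
                          (*-vanishˡ _ (to-diff 2a·b))

    injective : ∀ p q → E p ≈ᵥ E q → DN (p ≈ᵥ q)
    injective p q Ep≈Eq = dist²-definite p q (cancel 3d²≈0 (num-nonzero 2))
      where
      3d²≈0 : num 3 * dist² ℝ p q ≈ 0#
      3d²≈0 = trans (isometry p q) (trans (N-cong (⊖-cong Ep≈Eq ≈ᵥ-refl)) (N-self (E q)))

    E-O : E O ≈ᵥ v₀
    E-O = inner-origin O a , inner-origin O b

    E-A : E A ≈ᵥ v₁
    E-A = trans (*-congˡ a·a) (*-identityʳ _) , 2a·b

    E-B : E B ≈ᵥ v₂
    E-B = trans (*-congˡ (+-cong (*-comm _ _) (*-comm _ _))) 2a·b ,
          trans (*-congˡ b·b) (*-identityʳ _)

  minus-v₀ : ∀ x → x ⊖ v₀ ≈ᵥ x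
  minus-v₀ (x₁ , x₂) = coordinate x₁ , coordinate x₂
    where
    coordinate : ∀ x → x - 0# ≈ x
    coordinate = solve 1 (λ x → x :- κ 0 := x) refl

  -- Counterclockwise triangle, y = x + rot (z - x): the unit vectors
  -- x - v₀, rot² (z - v₂) and rot (v₈ - y) add up to 3 v₂.
  counterclockwise-sum : ∀ x z →
    (x ⊖ v₀) ⊕ rot (rot (z ⊖ v₂)) ⊕ rot (v₈ ⊖ (x ⊕ rot (z ⊖ x))) ≈ᵥ num 3 · v₂
  counterclockwise-sum (x₁ , x₂) (z₁ , z₂) =
    solve 4 (λ x₁ x₂ z₁ z₂ → proj₁ (sum x₁ x₂ z₁ z₂) := κ 3 :* κ 1) refl x₁ x₂ z₁ z₂ ,
    solve 4 (λ x₁ x₂ z₁ z₂ → proj₂ (sum x₁ x₂ z₁ z₂) := κ 3 :* κ 2) refl x₁ x₂ z₁ z₂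
    where
    sum : ∀ {m} → Polynomial m → Polynomial m → Polynomial m → Polynomial m → S.Vec2
    sum x₁ x₂ z₁ z₂ = let x = x₁ , x₂ ; z = z₁ , z₂ in
      (x S.⊖ S.pt 0 0) S.⊕ S.rot (S.rot (z S.⊖ S.pt 1 2)) S.⊕ S.rot (S.pt 5 4 S.⊖ (x S.⊕ S.rot (z S.⊖ x)))

  N-v₂ : N v₂ ≈ num 3
  N-v₂ = solve 0 (S.N (S.pt 1 2) := κ 3) refl

  counterclockwise : ∀ x z → N (x ⊖ v₀) ≈ num 3 → N (z ⊖ v₂) ≈ num 3 →
                     N (x ⊕ rot (z ⊖ x) ⊖ v₈) ≈ num 3 → DN (x ≈ᵥ v₂)
  counterclockwise x z x₀ z₂ y₈ = ≈ᵥ-trans (≈ᵥ-sym (minus-v₀ x)) <$>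
    three-equal (x ⊖ v₀) (rot (rot (z ⊖ v₂))) (rot (v₈ ⊖ y)) v₂
      x₀ (trans (N-rot _) (trans (N-rot _) z₂)) (trans (N-rot _) (trans (N-sym v₈ y) y₈)) N-v₂
      (counterclockwise-sum x z)
    where
    y : Vec2
    y = x ⊕ rot (z ⊖ x)

  -- Clockwise triangle, y = x + rot⁻¹ w with w = z - x: x lies on the unit
  -- circles around v₀, v₂ - w and v₈ - rot⁻¹ w, and the circumradius
  -- relation for these centres holds only for w = v₂.
  clockwise-centre₁ : ∀ x z → x ⊖ (v₂ ⊖ (z ⊖ x)) ≈ᵥ z ⊖ v₂
  clockwise-centre₁ (x₁ , x₂) (z₁ , z₂) = coordinate x₁ z₁ (num 1) , coordinate x₂ z₂ (num 2)
    where
    coordinate : ∀ x z v → x - (v - (z - x)) ≈ z - v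
    coordinate = solve 3 (λ x z v → x :- (v :- (z :- x)) := z :- v) refl

  third-centre : v₈ ⊖ rot⁻¹ v₂ ≈ᵥ v₇
  third-centre = solve 0 (proj₁ (S.pt 5 4 S.⊖ S.rot⁻¹ (S.pt 1 2)) := κ 3) refl ,
                 solve 0 (proj₂ (S.pt 5 4 S.⊖ S.rot⁻¹ (S.pt 1 2)) := κ 3) refl

  -- The circumradius relation on the unit circle N w = 3: its defect is a
  -- positive multiple of N(w - v₂)², up to a multiple of N w - 3.
  circle-identity : ∀ w →
    (N (num 2 · (w ⊖ v₂) ⊕ pt 6 3) + num 9) * (N (w ⊖ v₂) * N (w ⊖ v₂)) ≈
    (N (v₂ ⊖ w ⊖ v₀) * N (v₈ ⊖ rot⁻¹ w ⊖ v₀) * N ((v₂ ⊖ w) ⊖ (v₈ ⊖ rot⁻¹ w))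
       - num 3 * num 3 * (det (v₂ ⊖ w ⊖ v₀) (v₈ ⊖ rot⁻¹ w ⊖ v₀)
                          * det (v₂ ⊖ w ⊖ v₀) (v₈ ⊖ rot⁻¹ w ⊖ v₀)))
    + (N w - num 3) * (num 3 * (N (w ⊖ v₂) * N (w ⊖ v₂)) + num 9 * (proj₁ (w ⊖ v₂) + 1#) * N (w ⊖ v₂)
                       - num 27 * proj₁ (w ⊖ v₂))
  circle-identity (w₁ , w₂) = solve 2 (λ w₁ w₂ →
    let w = w₁ , w₂ ; s = w S.⊖ S.pt 1 2 ; o = S.pt 0 0
        p = S.pt 1 2 S.⊖ w S.⊖ o ; q = S.pt 5 4 S.⊖ S.rot⁻¹ w S.⊖ o in
    (S.N (κ 2 S.· s S.⊕ S.pt 6 3) :+ κ 9) :* (S.N s :* S.N s) :=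
    (S.N p :* S.N q :* S.N ((S.pt 1 2 S.⊖ w) S.⊖ (S.pt 5 4 S.⊖ S.rot⁻¹ w))
       :- κ 3 :* κ 3 :* (S.det p q :* S.det p q))
    :+ (S.N w :- κ 3) :* (κ 3 :* (S.N s :* S.N s) :+ κ 9 :* (proj₁ s :+ κ 1) :* S.N s :- κ 27 :* proj₁ s))
    refl w₁ w₂

  N-v₁-v₀ : N (v₁ ⊖ v₀) ≈ num 3
  N-v₁-v₀ = solve 0 (S.N (S.pt 2 1 S.⊖ S.pt 0 0) := κ 3) refl

  N-v₁-v₇ : N (v₁ ⊖ v₇) ≈ num 3
  N-v₁-v₇ = solve 0 (S.N (S.pt 2 1 S.⊖ S.pt 3 3) := κ 3) refl

  v₀≉v₇ : ¬ v₀ ≈ᵥ v₇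
  v₀≉v₇ (0≈3 , _) = num-nonzero 2 (sym 0≈3)

  clockwise : ∀ x z → N (x ⊖ v₀) ≈ num 3 → N (z ⊖ v₂) ≈ num 3 →
              N (x ⊕ rot⁻¹ (z ⊖ x) ⊖ v₈) ≈ num 3 → N (x ⊖ z) ≈ num 3 →
              ¬ x ≈ᵥ v₁ → DN (x ≈ᵥ v₂)
  clockwise x z x₀ z₂ y₈ xz x≉v₁ = do
      N[w-v₂]≈0 ← square-zero (cancel G*N[w-v₂]²≈0 G≉0)
      w≈v₂ ← N-definite w v₂ N[w-v₂]≈0
      -- now x is at unit distance from v₀ and v₇, like v₁
      x≈v₀+v₇-v₁ ← rhombus v₁ v₀ v₇ x N-v₁-v₀ N-v₁-v₇ x₀ (x₇ w≈v₂) v₀≉v₇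
                             (λ v₁≈x → x≉v₁ (≈ᵥ-sym v₁≈x))
      pure (≈ᵥ-trans x≈v₀+v₇-v₁ (lattice-step 0 0 3 3 2 1 1 2 ≡.refl ≡.refl))
    where
    w : Vec2
    w = z ⊖ x
    x₁ : N (x ⊖ (v₂ ⊖ w)) ≈ num 3
    x₁ = trans (N-cong (clockwise-centre₁ x z)) z₂
    x₂ : N (x ⊖ (v₈ ⊖ rot⁻¹ w)) ≈ num 3
    x₂ = trans (N-cong (⊖-⊖ x v₈ (rot⁻¹ w))) y₈
    G≉0 : ¬ N (num 2 · (w ⊖ v₂) ⊕ pt 6 3) + num 9 ≈ 0#
    G≉0 = offset-nonzero 8 (N-nonneg _)
    G*N[w-v₂]²≈0 : (N (num 2 · (w ⊖ v₂) ⊕ pt 6 3) + num 9) * (N (w ⊖ v₂) * N (w ⊖ v₂)) ≈ 0#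
    G*N[w-v₂]²≈0 = trans (circle-identity w)
      (+-vanish (to-diff (sym (circumradius x v₀ (v₂ ⊖ w) (v₈ ⊖ rot⁻¹ w) x₀ x₁ x₂)))
                (*-vanishˡ _ (to-diff (trans (N-sym z x) xz))))
    x₇ : w ≈ᵥ v₂ → N (x ⊖ v₇) ≈ num 3
    x₇ w≈v₂ = trans (N-cong (⊖-cong ≈ᵥ-refl centre)) x₂
      where
      centre : v₇ ≈ᵥ v₈ ⊖ rot⁻¹ w
      centre = ≈ᵥ-trans (≈ᵥ-sym third-centre) (⊖-cong ≈ᵥ-refl (rot⁻¹-cong (≈ᵥ-sym w≈v₂)))

  unit-triangle : ∀ x y z → N (x ⊖ v₀) ≈ num 3 → N (z ⊖ v₂) ≈ num 3 → N (y ⊖ v₈) ≈ num 3 →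
                  N (x ⊖ y) ≈ num 3 → N (y ⊖ z) ≈ num 3 → N (x ⊖ z) ≈ num 3 →
                  ¬ x ≈ᵥ v₁ → ¬ x ≈ᵥ v₂ → ⊥
  unit-triangle x y z x₀ z₂ y₈ xy yz xz x≉v₁ = orientation >>= λ where
      (inj₁ ccw) → counterclockwise x z x₀ z₂ (y-position ccw)
      (inj₂ cw)  → clockwise x z x₀ z₂ (y-position cw) xz x≉v₁
    where
    orientation : DN (y ⊖ x ≈ᵥ rot (z ⊖ x) ⊎ y ⊖ x ≈ᵥ rot⁻¹ (z ⊖ x))
    orientation = equilateral (y ⊖ x) (z ⊖ x) (trans (N-sym y x) xy) (trans (N-sym z x) xz)
                              (trans (N-cong (⊖-translate y z x)) yz)
    y-position : ∀ {t} → y ⊖ x ≈ᵥ t → N (x ⊕ t ⊖ v₈) ≈ num 3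
    y-position y-x≈t = trans (N-cong (⊖-cong (≈ᵥ-sym (⊖-solve y-x≈t)) ≈ᵥ-refl)) y₈

  run : DN ⊥ → ⊥
  run m = m id

  placed : ∀ {A B C D A′ B′ C′ D′} → D ≈ᵥ B ⊕ C ⊖ A → B ≈ᵥ B′ → C ≈ᵥ C′ → A ≈ᵥ A′ →
           B′ ⊕ C′ ⊖ A′ ≈ᵥ D′ → D ≈ᵥ D′
  placed D≈ B≈ C≈ A≈ lattice = ≈ᵥ-trans D≈ (≈ᵥ-trans (⊖-cong (⊕-cong B≈ C≈) A≈) lattice)

  near : ∀ {x y P} → N (x ⊖ y) ≈ num 3 → y ≈ᵥ P → N (x ⊖ P) ≈ num 3
  near xy y≈P = trans (N-cong (⊖-cong ≈ᵥ-refl (≈ᵥ-sym y≈P))) xy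

  main : ¬ UnitDistance ℝ F-9-15-17
  main (φ , φ-injective , φ-unit) = run do
      p₇ ← position₇
      p₆ ← position₆ p₇
      p₈ ← position₈ p₇ p₆
      pure (unit-triangle (e (# 3)) (e (# 4)) (e (# 5))
              (near (edge′ (# 0) (# 3)) p₀) (near (edge′ (# 2) (# 5)) p₂) (near (edge (# 4) (# 8)) p₈)
              (edge (# 3) (# 4)) (edge (# 4) (# 5)) (edge (# 3) (# 5))
              (away (# 3) (# 1) p₁ (λ ())) (away (# 3) (# 2) p₂ (λ ())))
    where
    adjacent : ∀ i j → {True ((i , j) ∈? F-9-15-17)} → dist² ℝ (φ i) (φ j) ≈ 1#
    adjacent i j {i~j} = φ-unit i j (toWitness i~j)

    open EisensteinCoordinates (φ (# 0)) (φ (# 1)) (φ (# 2))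
           (adjacent (# 0) (# 1)) (adjacent (# 0) (# 2)) (adjacent (# 1) (# 2))

    e : Fin 9 → Vec2
    e i = E (φ i)

    p₀ : e (# 0) ≈ᵥ v₀
    p₀ = E-O
    p₁ : e (# 1) ≈ᵥ v₁
    p₁ = E-A
    p₂ : e (# 2) ≈ᵥ v₂
    p₂ = E-B

    edge : ∀ i j → {True ((i , j) ∈? F-9-15-17)} → N (e i ⊖ e j) ≈ num 3
    edge i j {i~j} =
      trans (sym (isometry (φ i) (φ j))) (trans (*-congˡ (adjacent i j {i~j})) (*-identityʳ _))

    edge′ : ∀ i j → {True ((i , j) ∈? F-9-15-17)} → N (e j ⊖ e i) ≈ num 3
    edge′ i j {i~j} = trans (N-sym (e j) (e i)) (edge i j {i~j})

    distinct : ∀ i j → ¬ i ≡ j → ¬ e i ≈ᵥ e j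
    distinct i j i≢j ei≈ej = injective (φ i) (φ j) ei≈ej (λ φi≈φj → i≢j (φ-injective i j φi≈φj))

    away : ∀ i j {P} → e j ≈ᵥ P → ¬ i ≡ j → ¬ e i ≈ᵥ P
    away i j ej≈P i≢j ei≈P = distinct i j i≢j (≈ᵥ-trans ei≈P (≈ᵥ-sym ej≈P))

    -- 7 is adjacent to 1, 2 like 0; then 6 to 1, 7 like 2; then 8 to 6, 7 like 1
    position₇ : DN (e (# 7) ≈ᵥ v₇)
    position₇ = (λ e₇ → placed e₇ p₁ p₂ p₀ (lattice-step 2 1 1 2 0 0 3 3 ≡.refl ≡.refl)) <$>
      rhombus (e (# 0)) (e (# 1)) (e (# 2)) (e (# 7))
        (edge (# 0) (# 1)) (edge (# 0) (# 2)) (edge′ (# 1) (# 7)) (edge′ (# 2) (# 7))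
        (distinct (# 1) (# 2) (λ ())) (distinct (# 0) (# 7) (λ ()))

    position₆ : e (# 7) ≈ᵥ v₇ → DN (e (# 6) ≈ᵥ v₆)
    position₆ p₇ = (λ e₆ → placed e₆ p₁ p₇ p₂ (lattice-step 2 1 3 3 1 2 4 2 ≡.refl ≡.refl)) <$>
      rhombus (e (# 2)) (e (# 1)) (e (# 7)) (e (# 6))
        (edge′ (# 1) (# 2)) (edge (# 2) (# 7)) (edge′ (# 1) (# 6)) (edge (# 6) (# 7))
        (distinct (# 1) (# 7) (λ ())) (distinct (# 2) (# 6) (λ ()))

    position₈ : e (# 7) ≈ᵥ v₇ → e (# 6) ≈ᵥ v₆ → DN (e (# 8) ≈ᵥ v₈)
    position₈ p₇ p₆ = (λ e₈ → placed e₈ p₆ p₇ p₁ (lattice-step 4 2 3 3 2 1 5 4 ≡.refl ≡.refl)) <$>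
      rhombus (e (# 1)) (e (# 6)) (e (# 7)) (e (# 8))
        (edge (# 1) (# 6)) (edge (# 1) (# 7)) (edge′ (# 6) (# 8)) (edge′ (# 7) (# 8))
        (distinct (# 6) (# 7) (λ ())) (distinct (# 1) (# 8) (λ ()))

mainTheorem12 : Forbidden F-9-15-17
mainTheorem12 ℝ = Proof.main ℝ
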